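{- For all integers $0\le r\le n$, the lattices $S(n,r)$ and $S(r,r)\times S(n-r,0)$ are isomorphic (as posets, with the product order on the right-hand side).
   Context: For integers $0\le r\le n$, let $A(n,r)$ be an alphabet of $n+1$ formal symbols $\tilde 1,\dots,\tilde r,\ 0^\S,\ \bar 1,\dots,\overline{n-r}$, totally ordered by $\overline{n-r}\prec\cdots\prec\bar1\prec 0^\S\prec\tilde1\prec\cdots\prec\tilde r$. $S(n,r)$ is the set of strings $w=i_1\cdots i_r\,|\,j_1\cdots j_{n-r}$ with $i_k\in\{\tilde1,\dots,\tilde r,0^\S\}$, $j_k\in\{0^\S,\bar1,\dots,\overline{n-r}\}$ such that for some $0\le p\le r$, $1\le q\le n-r+1$: $i_1\succ\cdots\succ i_p\succ 0^\S=i_{p+1}=\cdots=i_r$ and $j_1=\cdots=j_{q-1}=0^\S\succ j_q\succ\cdots\succ j_{n-r}$, ordered componentwise by $\preceq$ (the order is written $\sqsubseteq$). $S(0,0)$ is a single (empty) string. -}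

module Defs where

open import Data.Nat using (ℕ; _≤_; _<_; _∸_; suc)
open import Data.Fin using (Fin; toℕ)
open import Data.Vec using (Vec; lookup)
open import Data.Product using (Σ; _×_; proj₁; proj₂)
open import Relation.Binary.PropositionalEquality using (_≡_)
open import Relation.Nullary using (¬_)
open import Data.Empty using (⊥)
open import Data.Unit using (⊤)

-- The alphabet A(n,r) with r = number of tilde symbols, m = n - r = number
-- of bar symbols.  tilde i stands for the symbol (toℕ i + 1)~, bar i for
-- the symbol overline(toℕ i + 1), and zero§ for 0^§.
data Sym (r m : ℕ) : Set where
  tilde : Fin r → Sym r m
  zero§ : Sym r m
  bar   : Fin m → Sym r m

_≼_ : ∀ {r m} → Sym r m → Sym r m → Set
tilde i ≼ tilde j = toℕ i ≤ toℕ j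
tilde i ≼ zero§   = ⊥
tilde i ≼ bar j   = ⊥
zero§   ≼ tilde j = ⊤
zero§   ≼ zero§   = ⊤
zero§   ≼ bar j   = ⊥
bar i   ≼ tilde j = ⊤
bar i   ≼ zero§   = ⊤
bar i   ≼ bar j   = toℕ j ≤ toℕ i

_≺_ : ∀ {r m} → Sym r m → Sym r m → Set
a ≺ b = (a ≼ b) × ¬ (a ≡ b)

IsTildeOrZero : ∀ {r m} → Sym r m → Set
IsTildeOrZero (tilde _) = ⊤
IsTildeOrZero zero§     = ⊤
IsTildeOrZero (bar _)   = ⊥

IsBarOrZero : ∀ {r m} → Sym r m → Set
IsBarOrZero (tilde _) = ⊥
IsBarOrZero zero§     = ⊤
IsBarOrZero (bar _)   = ⊤

-- Condition on the first block i_1 … i_r (positions 0-indexed):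
-- there is p ≤ r with i_1 ≻ … ≻ i_p ≻ 0^§ = i_{p+1} = … = i_r.
ValidI : ∀ {r m} → Vec (Sym r m) r → Set
ValidI {r} {m} v =
  (∀ k → IsTildeOrZero (lookup v k)) ×
  Σ ℕ λ p → p ≤ r ×
    ((∀ (k : Fin r) → toℕ k < p → zero§ ≺ lookup v k) ×
     (∀ (k l : Fin r) → suc (toℕ k) ≡ toℕ l → toℕ l < p → lookup v l ≺ lookup v k) ×
     (∀ (k : Fin r) → p ≤ toℕ k → lookup v k ≡ zero§))

-- Condition on the second block j_1 … j_m (positions 0-indexed):
-- there is 1 ≤ q ≤ m+1 with j_1 = … = j_{q-1} = 0^§ ≻ j_q ≻ … ≻ j_m.
-- With q' = q - 1 (0 ≤ q' ≤ m): positions < q' are 0^§, positions ≥ q'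
-- are ≺ 0^§ and strictly decreasing.
ValidJ : ∀ {r m} → Vec (Sym r m) m → Set
ValidJ {r} {m} v =
  (∀ k → IsBarOrZero (lookup v k)) ×
  Σ ℕ λ q' → q' ≤ m ×
    ((∀ (k : Fin m) → toℕ k < q' → lookup v k ≡ zero§) ×
     (∀ (k : Fin m) → q' ≤ toℕ k → lookup v k ≺ zero§) ×
     (∀ (k l : Fin m) → suc (toℕ k) ≡ toℕ l → q' ≤ toℕ k → lookup v l ≺ lookup v k))

Word : ℕ → ℕ → Set
Word r m = Vec (Sym r m) r × Vec (Sym r m) m

-- S'(r, m) = S(r + m, r).
S' : ℕ → ℕ → Set
S' r m = Σ (Word r m) λ w → ValidI (proj₁ w) × ValidJ (proj₂ w)

S : ℕ → ℕ → Set
S n r = S' r (n ∸ r)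

_≈S_ : ∀ {r m} → S' r m → S' r m → Set
x ≈S y = proj₁ x ≡ proj₁ y

_⊑_ : ∀ {r m} → S' r m → S' r m → Set
x ⊑ y = (∀ k → lookup (proj₁ (proj₁ x)) k ≼ lookup (proj₁ (proj₁ y)) k) ×
        (∀ k → lookup (proj₂ (proj₁ x)) k ≼ lookup (proj₂ (proj₁ y)) k)

_≈×_ : ∀ {r m r' m'} → S' r m × S' r' m' → S' r m × S' r' m' → Set
x ≈× y = (proj₁ x ≈S proj₁ y) × (proj₂ x ≈S proj₂ y)

_⊑×_ : ∀ {r m r' m'} → S' r m × S' r' m' → S' r m × S' r' m' → Set
x ⊑× y = (proj₁ x ⊑ proj₁ y) × (proj₂ x ⊑ proj₂ y)

-- A valid first block i₁…i_r only uses the symbols 0^§, 1̃, …, r̃ and a valid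
-- second block only uses 0^§, 1̄, …, (n−r)‾, and the validity conditions and
-- the componentwise order only compare symbols inside a block.  Forgetting
-- the bars of the first block and the tildes of the second block therefore
-- moves the two halves of a string into A(r,r) and A(n−r,0) without changing
-- validity or order; the same maps read backwards reassemble the string.
module Submission where

open import Defs
open import Data.Nat using (ℕ; _≤_; _∸_; z≤n)
open import Data.Nat.Properties using (≤-refl; ≤-antisym; n∸n≡0)
open import Data.Fin using (toℕ)
open import Data.Fin.Properties using (toℕ-injective)
open import Data.Vec using (Vec; []; map; lookup; tabulate)
open import Data.Vec.Properties using (lookup-map; tabulate∘lookup; tabulate-cong; map-∘; map-cong; map-id)
open import Data.Product using (Σ; _×_; _,_; proj₁)
open import Data.Unit using (tt)
open import Function using (id; _∘_)
open import Relation.Binary.PropositionalEquality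
open import Relation.Binary.Morphism.Structures using (IsOrderIsomorphism)

≼-refl : ∀ {r m} (x : Sym r m) → x ≼ x
≼-refl (tilde i) = ≤-refl
≼-refl zero§     = tt
≼-refl (bar i)   = ≤-refl

≡⇒≼ : ∀ {r m} {x y : Sym r m} → x ≡ y → x ≼ y
≡⇒≼ {x = x} refl = ≼-refl x

≼-antisym : ∀ {r m} {x y : Sym r m} → x ≼ y → y ≼ x → x ≡ y
≼-antisym {x = tilde i} {tilde j} i≤j j≤i = cong tilde (toℕ-injective (≤-antisym i≤j j≤i))
≼-antisym {x = tilde i} {zero§}   ()  _
≼-antisym {x = tilde i} {bar j}   ()  _
≼-antisym {x = zero§}   {tilde j} _   ()
≼-antisym {x = zero§}   {zero§}   _   _  = refl
≼-antisym {x = zero§}   {bar j}   ()  _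
≼-antisym {x = bar i}   {tilde j} _   ()
≼-antisym {x = bar i}   {zero§}   _   ()
≼-antisym {x = bar i}   {bar j}   j≤i i≤j = cong bar (toℕ-injective (≤-antisym i≤j j≤i))

_≼ᵛ_ : ∀ {r m n} → Vec (Sym r m) n → Vec (Sym r m) n → Set
u ≼ᵛ v = ∀ k → lookup u k ≼ lookup v k

≼ᵛ-antisym : ∀ {r m n} {u v : Vec (Sym r m) n} → u ≼ᵛ v → v ≼ᵛ u → u ≡ v
≼ᵛ-antisym {u = u} {v} u≼v v≼u = begin
  u                    ≡⟨ tabulate∘lookup u ⟨
  tabulate (lookup u)  ≡⟨ tabulate-cong (λ k → ≼-antisym (u≼v k) (v≼u k)) ⟩
  tabulate (lookup v)  ≡⟨ tabulate∘lookup v ⟩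
  v                    ∎
  where open ≡-Reasoning

≈S⇒⊑ : ∀ {r m} {x y : S' r m} → x ≈S y → x ⊑ y
≈S⇒⊑ refl = (λ _ → ≼-refl _) , (λ _ → ≼-refl _)

≈×⇒⊑× : ∀ {r m r' m'} {x y : S' r m × S' r' m'} → x ≈× y → x ⊑× y
≈×⇒⊑× {x = x₁ , x₂} {y₁ , y₂} (e₁ , e₂) = ≈S⇒⊑ {x = x₁} {y₁} e₁ , ≈S⇒⊑ {x = x₂} {y₂} e₂

⊑-antisym : ∀ {r m} {x y : S' r m} → x ⊑ y → y ⊑ x → x ≈S y
⊑-antisym (I≼I' , J≼J') (I'≼I , J'≼J) = cong₂ _,_ (≼ᵛ-antisym I≼I' I'≼I) (≼ᵛ-antisym J≼J' J'≼J)

record ZeroFixingEmbeddingOn {a b c d : ℕ} (P : Sym a b → Set) (Q : Sym c d → Set)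
                             (φ : Sym a b → Sym c d) : Set where
  field
    maps-into   : ∀ {x} → P x → Q (φ x)
    fixes-zero§ : φ zero§ ≡ zero§
    monotone    : ∀ {x y} → P x → P y → x ≼ y → φ x ≼ φ y
    cancel      : ∀ {x y} → P x → P y → φ x ≼ φ y → x ≼ y

  strictly-monotone : ∀ {x y} → P x → P y → x ≺ y → φ x ≺ φ y
  strictly-monotone px py (x≼y , x≢y) =
    monotone px py x≼y ,
    λ φx≡φy → x≢y (≼-antisym (cancel px py (≡⇒≼ φx≡φy)) (cancel py px (≡⇒≼ (sym φx≡φy))))

  module _ {n : ℕ} where

    map-maps-into : {v : Vec (Sym a b) n} → (∀ k → P (lookup v k)) → ∀ k → Q (lookup (map φ v) k)
    map-maps-into {v} Pv k = subst Q (sym (lookup-map k φ v)) (maps-into (Pv k))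

    map-monotone : {u v : Vec (Sym a b) n} → (∀ k → P (lookup u k)) → (∀ k → P (lookup v k)) →
                   u ≼ᵛ v → map φ u ≼ᵛ map φ v
    map-monotone {u} {v} Pu Pv u≼v k =
      subst₂ _≼_ (sym (lookup-map k φ u)) (sym (lookup-map k φ v)) (monotone (Pu k) (Pv k) (u≼v k))

    map-cancel : {u v : Vec (Sym a b) n} → (∀ k → P (lookup u k)) → (∀ k → P (lookup v k)) →
                 map φ u ≼ᵛ map φ v → u ≼ᵛ v
    map-cancel {u} {v} Pu Pv φu≼φv k =
      cancel (Pu k) (Pv k) (subst₂ _≼_ (lookup-map k φ u) (lookup-map k φ v) (φu≼φv k))

module _ {r m m' : ℕ} {φ : Sym r m → Sym r m'}
         (E : ZeroFixingEmbeddingOn IsTildeOrZero IsTildeOrZero φ) where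
  open ZeroFixingEmbeddingOn E

  map-preserves-ValidI : {v : Vec (Sym r m) r} → ValidI v → ValidI (map φ v)
  map-preserves-ValidI {v} (Pv , p , p≤r , above-zero§ , decreasing , zero§-tail) =
    map-maps-into {v = v} Pv , p , p≤r ,
    (λ k k<p → subst₂ _≺_ fixes-zero§ (sym (φv k))
                 (strictly-monotone tt (Pv k) (above-zero§ k k<p))) ,
    (λ k l k+1≡l l<p → subst₂ _≺_ (sym (φv l)) (sym (φv k))
                         (strictly-monotone (Pv l) (Pv k) (decreasing k l k+1≡l l<p))) ,
    (λ k p≤k → trans (φv k) (trans (cong φ (zero§-tail k p≤k)) fixes-zero§))
    where
    φv : ∀ k → lookup (map φ v) k ≡ φ (lookup v k)
    φv k = lookup-map k φ v

module _ {r r' m : ℕ} {φ : Sym r m → Sym r' m}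
         (E : ZeroFixingEmbeddingOn IsBarOrZero IsBarOrZero φ) where
  open ZeroFixingEmbeddingOn E

  map-preserves-ValidJ : {v : Vec (Sym r m) m} → ValidJ v → ValidJ (map φ v)
  map-preserves-ValidJ {v} (Pv , q , q≤m , zero§-head , below-zero§ , decreasing) =
    map-maps-into {v = v} Pv , q , q≤m ,
    (λ k k<q → trans (φv k) (trans (cong φ (zero§-head k k<q)) fixes-zero§)) ,
    (λ k q≤k → subst₂ _≺_ (sym (φv k)) fixes-zero§
                 (strictly-monotone (Pv k) tt (below-zero§ k q≤k))) ,
    (λ k l k+1≡l q≤k → subst₂ _≺_ (sym (φv l)) (sym (φv k))
                         (strictly-monotone (Pv l) (Pv k) (decreasing k l k+1≡l q≤k)))
    where
    φv : ∀ k → lookup (map φ v) k ≡ φ (lookup v k)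
    φv k = lookup-map k φ v

ValidI-[] : ∀ {m} → ValidI {0} {m} []
ValidI-[] = (λ ()) , 0 , z≤n , (λ ()) , (λ ()) , (λ ())

ValidJ-[] : ∀ {r} → ValidJ {r} {0} []
ValidJ-[] = (λ ()) , 0 , z≤n , (λ ()) , (λ ()) , (λ ())

dropBars : ∀ {r m m'} → Sym r m → Sym r m'
dropBars (tilde i) = tilde i
dropBars zero§     = zero§
dropBars (bar _)   = zero§

dropTildes : ∀ {r r' m} → Sym r m → Sym r' m
dropTildes (tilde _) = zero§
dropTildes zero§     = zero§
dropTildes (bar j)   = bar j

dropBars-≼ : ∀ {r m m'} {x y : Sym r m} → IsTildeOrZero x → IsTildeOrZero y →
             (dropBars {m' = m'} x ≼ dropBars y) ≡ (x ≼ y)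
dropBars-≼ {x = tilde _} {tilde _} _ _ = refl
dropBars-≼ {x = tilde _} {zero§}   _ _ = refl
dropBars-≼ {x = zero§}   {tilde _} _ _ = refl
dropBars-≼ {x = zero§}   {zero§}   _ _ = refl
dropBars-≼ {x = bar _}             () _
dropBars-≼ {x = tilde _} {bar _}   _ ()
dropBars-≼ {x = zero§}   {bar _}   _ ()

dropTildes-≼ : ∀ {r r' m} {x y : Sym r m} → IsBarOrZero x → IsBarOrZero y →
               (dropTildes {r' = r'} x ≼ dropTildes y) ≡ (x ≼ y)
dropTildes-≼ {x = bar _} {bar _}   _ _ = refl
dropTildes-≼ {x = bar _} {zero§}   _ _ = refl
dropTildes-≼ {x = zero§} {bar _}   _ _ = refl
dropTildes-≼ {x = zero§} {zero§}   _ _ = refl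
dropTildes-≼ {x = tilde _}         () _
dropTildes-≼ {x = bar _} {tilde _} _ ()
dropTildes-≼ {x = zero§} {tilde _} _ ()

dropBars-embedding : ∀ {r m m'} →
                     ZeroFixingEmbeddingOn IsTildeOrZero IsTildeOrZero (dropBars {r} {m} {m'})
dropBars-embedding = record
  { maps-into   = λ { {tilde _} _ → tt ; {zero§} _ → tt }
  ; fixes-zero§ = refl
  ; monotone    = λ px py → subst id (sym (dropBars-≼ px py))
  ; cancel      = λ px py → subst id (dropBars-≼ px py)
  }

dropTildes-embedding : ∀ {r r' m} →
                       ZeroFixingEmbeddingOn IsBarOrZero IsBarOrZero (dropTildes {r} {r'} {m})
dropTildes-embedding = record
  { maps-into   = λ { {bar _} _ → tt ; {zero§} _ → tt }
  ; fixes-zero§ = refl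
  ; monotone    = λ px py → subst id (sym (dropTildes-≼ px py))
  ; cancel      = λ px py → subst id (dropTildes-≼ px py)
  }

dropBars-dropBars : ∀ {r m} (s : Sym r 0) → dropBars (dropBars {m' = m} s) ≡ s
dropBars-dropBars (tilde _) = refl
dropBars-dropBars zero§     = refl

dropTildes-dropTildes : ∀ {r m} (s : Sym 0 m) → dropTildes (dropTildes {r' = r} s) ≡ s
dropTildes-dropTildes zero§   = refl
dropTildes-dropTildes (bar _) = refl

map-involutive : ∀ {A B : Set} {n} {f : A → B} {g : B → A} → (∀ s → f (g s) ≡ s) →
                 (v : Vec B n) → map f (map g v) ≡ v
map-involutive {f = f} {g} fg≗id v = begin
  map f (map g v)  ≡⟨ map-∘ f g v ⟨
  map (f ∘ g) v    ≡⟨ map-cong fg≗id v ⟩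
  map id v         ≡⟨ map-id v ⟩
  v                ∎
  where open ≡-Reasoning

module _ (r m : ℕ) where

  split : S' r m → S' r 0 × S' 0 m
  split ((I , J) , (vI , vJ)) =
    ((map dropBars I , []) , (map-preserves-ValidI dropBars-embedding {I} vI , ValidJ-[])) ,
    (([] , map dropTildes J) , (ValidI-[] , map-preserves-ValidJ dropTildes-embedding {J} vJ))

  merge : S' r 0 × S' 0 m → S' r m
  merge (((I , _) , (vI , _)) , ((_ , J) , (_ , vJ))) =
    (map dropBars I , map dropTildes J) ,
    (map-preserves-ValidI dropBars-embedding {I} vI , map-preserves-ValidJ dropTildes-embedding {J} vJ)

  private
    module Bars   = ZeroFixingEmbeddingOn (dropBars-embedding {r} {m} {0})
    module Tildes = ZeroFixingEmbeddingOn (dropTildes-embedding {r} {0} {m})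

  split-monotone : ∀ {x y} → x ⊑ y → split x ⊑× split y
  split-monotone {(I , J) , (vI , vJ)} {(I' , J') , (vI' , vJ')} (I≼I' , J≼J') =
    (Bars.map-monotone {u = I} {I'} (proj₁ vI) (proj₁ vI') I≼I' , λ ()) ,
    ((λ ()) , Tildes.map-monotone {u = J} {J'} (proj₁ vJ) (proj₁ vJ') J≼J')

  split-cancel : ∀ {x y} → split x ⊑× split y → x ⊑ y
  split-cancel {(I , J) , (vI , vJ)} {(I' , J') , (vI' , vJ')} ((I≼I' , _) , (_ , J≼J')) =
    Bars.map-cancel {u = I} {I'} (proj₁ vI) (proj₁ vI') I≼I' ,
    Tildes.map-cancel {u = J} {J'} (proj₁ vJ) (proj₁ vJ') J≼J'

  split-injective : ∀ {x y} → split x ≈× split y → x ≈S y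
  split-injective {x} {y} (e₁ , e₂) =
    ⊑-antisym {x = x} {y} (split-cancel {x} {y} (≈×⇒⊑× {x = split x} {split y} (e₁ , e₂)))
                          (split-cancel {y} {x} (≈×⇒⊑× {x = split y} {split x} (sym e₁ , sym e₂)))

  split-merge : ∀ y → split (merge y) ≈× y
  split-merge (((I , []) , _) , (([] , J) , _)) =
    cong (_, []) (map-involutive dropBars-dropBars I) ,
    cong ([] ,_) (map-involutive dropTildes-dropTildes J)

  split-isOrderIsomorphism : IsOrderIsomorphism _≈S_ _≈×_ _⊑_ _⊑×_ split
  split-isOrderIsomorphism = record
    { isOrderMonomorphism = record
      { isOrderHomomorphism = record
        { cong = λ { {(I , J) , _} {(I , J) , _} refl → refl , refl }
        ; mono = λ {x} {y} → split-monotone {x} {y}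
        }
      ; injective = λ {x} {y} → split-injective {x} {y}
      ; cancel    = λ {x} {y} → split-cancel {x} {y}
      }
    ; surjective = λ y → merge y , λ { refl → split-merge y }
    }

mainTheorem3 : (n r : ℕ) → r ≤ n →
    Σ (S n r → S r r × S (n ∸ r) 0) λ f →
    IsOrderIsomorphism _≈S_ _≈×_ _⊑_ _⊑×_ f
mainTheorem3 n r _ rewrite n∸n≡0 r = split r (n ∸ r) , split-isOrderIsomorphism r (n ∸ r)
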